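{- Let $\sigma$ be a permutation with $n$ left-to-right minima and let $C$ be the set of active cells of its staircase encoding. Then (1) $C$ is an independent set of $\mathcal{U}(B_n)$ if $\sigma\in\mathrm{Av}(2314)\cup\mathrm{Av}(3124)$; (2) $C$ is an independent set of $\mathcal{D}(B_n)$ if $\sigma\in\mathrm{Av}(2413)\cup\mathrm{Av}(3142)$.
   Context: A permutation avoids $\pi$ if no subsequence has the same relative order as $\pi$; $\mathrm{Av}(\pi)$ is the set of such permutations. A left-to-right minimum of $\sigma$ is an entry $\sigma_i$ with $\sigma_j>\sigma_i$ for all $j<i$. Let $\sigma$ have left-to-right minima at positions $p_1<\dots<p_n$ with values $v_1>\dots>v_n$; $B_n=\{(i,j):1\le i\le j\le n\}$ (row $i$, column $j$, row 1 on top). Each non-minimum entry $\sigma_k$ lies in cell $(i,j)$, where $j$ is the largest index with $p_j<k$ and $i$ the smallest index with $v_i<\sigma_k$. A cell is active if it contains at least one entry of $\sigma$. $\mathcal{U}(B_n)$ is the graph on $B_n$ with an edge between $(i,j)$ and $(k,\ell)$ whenever $i>k$ and $j<\ell$. $\mathcal{D}(B_n)$ is the graph on $B_n$ with an edge between $(i,j)$ and $(k,\ell)$ whenever $i<k$, $j<\ell$ and $\{i,\dots,k\}\times\{j,\dots,\ell\}\subseteq B_n$. -}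

module Defs where

open import Data.Nat using (ℕ)
import Data.Nat as ℕ
open import Data.Fin using (Fin; toℕ; _<_; _≤_)
open import Data.Fin.Permutation using (Permutation′; _⟨$⟩ʳ_)
open import Data.Vec using (Vec; lookup; _∷_; [])
open import Data.Product using (Σ; _×_; ∃; ∃-syntax; _,_)
open import Function.Bundles using (_⇔_)
open import Relation.Binary.PropositionalEquality using (_≡_)
open import Relation.Nullary using (¬_)

val : ∀ {m} → Permutation′ m → Fin m → Fin m
val σ k = σ ⟨$⟩ʳ k

Contains : ∀ {m k} → Permutation′ m → Vec ℕ k → Set
Contains {m} {k} σ π =
  Σ (Fin k → Fin m) λ f →
    (∀ a b → a < b → f a < f b) ×
    (∀ a b → (lookup π a ℕ.< lookup π b) ⇔ (val σ (f a) < val σ (f b)))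

Avoids : ∀ {m k} → Permutation′ m → Vec ℕ k → Set
Avoids σ π = ¬ Contains σ π

p2314 p3124 p2413 p3142 : Vec ℕ 4
p2314 = 2 ∷ 3 ∷ 1 ∷ 4 ∷ []
p3124 = 3 ∷ 1 ∷ 2 ∷ 4 ∷ []
p2413 = 2 ∷ 4 ∷ 1 ∷ 3 ∷ []
p3142 = 3 ∷ 1 ∷ 4 ∷ 2 ∷ []

IsLRMin : ∀ {m} → Permutation′ m → Fin m → Set
IsLRMin σ k = ∀ j → j < k → val σ k < val σ j

-- p enumerates the left-to-right minima of σ in increasing order of
-- position: p 0 < p 1 < ... < p (n-1), and these are exactly the LR minima.
-- (So σ has exactly n LR minima; their values v_i = val σ (p i) decrease.)
LRMinEnum : ∀ {m n} → Permutation′ m → (Fin n → Fin m) → Set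
LRMinEnum {m} {n} σ p =
  (∀ a b → a < b → p a < p b) ×
  (∀ k → IsLRMin σ k ⇔ (∃[ i ] p i ≡ k))

-- The non-minimum entry at position k lies in cell (i , j)
-- (row i, column j; 0-based indices of the minima):
-- j is the largest index with p_j < k, i the smallest index with v_i < σ_k.
InCell : ∀ {m n} → Permutation′ m → (Fin n → Fin m) → Fin m → Fin n → Fin n → Set
InCell σ p k i j =
  ¬ IsLRMin σ k ×
  (p j < k) × (∀ j′ → j < j′ → ¬ (p j′ < k)) ×
  (val σ (p i) < val σ k) × (∀ i′ → i′ < i → ¬ (val σ (p i′) < val σ k))

Active : ∀ {m n} → Permutation′ m → (Fin n → Fin m) → Fin n → Fin n → Set
Active σ p i j = ∃[ k ] InCell σ p k i j

InB : ∀ {n} → Fin n → Fin n → Set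
InB i j = i ≤ j

EdgeU : ∀ {n} → Fin n → Fin n → Fin n → Fin n → Set
EdgeU i j k l = InB i j × InB k l × k < i × j < l

EdgeD : ∀ {n} → Fin n → Fin n → Fin n → Fin n → Set
EdgeD {n} i j k l =
  InB i j × InB k l × i < k × j < l ×
  (∀ (a b : Fin n) → i ≤ a → a ≤ k → j ≤ b → b ≤ l → InB a b)

Independent : ∀ {n} → (Fin n → Fin n → Fin n → Fin n → Set) →
              (Fin n → Fin n → Set) → Set
Independent {n} E S = ∀ (i j k l : Fin n) → S i j → S k l → ¬ E i j k l

-- Let x and y be non-minimum entries in two active cells (i , j) and
-- (k , l).  The cell of x pins it between the minima p_j and p_{j+1} in
-- position and between v_i and v_{i-1} in value, and likewise for y.  If
-- the cells are joined by an edge of U(B_n), the entries p_i, x, p_l, y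
-- and p_k, p_i, x, y (in order of position) form occurrences of 2314 and
-- 3124; for an edge of D(B_n) the rectangle condition gives k ≤ j, and
-- p_k, x, p_l, y and p_i, p_k, x, y form occurrences of 2413 and 3142.
module Submission where

open import Defs
open import Data.Nat using (ℕ; suc; s<s⁻¹)
import Data.Nat as ℕ
import Data.Nat.Properties as ℕ
open import Data.Fin using (Fin; toℕ; _<_; _≤_; #_)
open import Data.Fin.Properties
  using (<-trans; <-irrefl; <-asym; <-cmp; ≤-refl; ≤∧≢⇒<; toℕ-injective; all?; _≟_)
open import Data.Fin.Permutation using (Permutation′; _⟨$⟩ˡ_; inverseˡ)
open import Data.Vec using (Vec; lookup; tabulate; _∷_; [])
open import Data.Vec.Properties using (lookup∘tabulate)
open import Data.Vec.Relation.Unary.Linked using (Linked; _∷_; [-])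
import Data.Vec.Relation.Unary.Linked.Properties as Linked
open import Data.Product using (_×_; _,_; proj₁; proj₂)
open import Data.Sum using (_⊎_; [_,_])
open import Function using (_∘_)
open import Function.Bundles using (mk⇔; Equivalence)
open import Relation.Binary.PropositionalEquality
  using (_≡_; refl; sym; trans; cong; subst; subst₂)
open import Relation.Binary.Definitions using (tri<; tri≈; tri>)
open import Relation.Nullary using (contradiction)
open import Relation.Nullary.Decidable using (True; toWitness)

val-injective : ∀ {m} (σ : Permutation′ m) {a b} → val σ a ≡ val σ b → a ≡ b
val-injective σ {a} {b} e =
  trans (sym (inverseˡ σ)) (trans (cong (σ ⟨$⟩ˡ_) e) (inverseˡ σ))

record Ranking {k : ℕ} (π : Vec ℕ k) : Set where
  field
    rank        : Fin k → Fin k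
    unrank      : Fin k → Fin k
    unrank-rank : ∀ a → unrank (rank a) ≡ a
    lookup-rank : ∀ a → lookup π a ≡ suc (toℕ (rank a))

  rank-< : ∀ {a b} → lookup π a ℕ.< lookup π b → rank a < rank b
  rank-< {a} {b} lt = s<s⁻¹ (subst₂ ℕ._<_ (lookup-rank a) (lookup-rank b) lt)

  rank-injective : ∀ {a b} → rank a ≡ rank b → a ≡ b
  rank-injective {a} {b} e = trans (sym (unrank-rank a)) (trans (cong unrank e) (unrank-rank b))

  lookup-injective : ∀ {a b} → lookup π a ≡ lookup π b → a ≡ b
  lookup-injective {a} {b} e = rank-injective (toℕ-injective (ℕ.suc-injective
    (trans (sym (lookup-rank a)) (trans e (lookup-rank b)))))

ranking : ∀ {k} (π : Vec ℕ k) (ranks order : Vec (Fin k) k) →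
  {_ : True (all? λ a → lookup order (lookup ranks a) ≟ a)} →
  {_ : True (all? λ a → lookup π a ℕ.≟ suc (toℕ (lookup ranks a)))} →
  Ranking π
ranking π ranks order {inverse} {values} = record
  { rank        = lookup ranks
  ; unrank      = lookup order
  ; unrank-rank = toWitness inverse
  ; lookup-rank = toWitness values
  }

ranking2314 : Ranking p2314
ranking2314 = ranking p2314 (# 1 ∷ # 2 ∷ # 0 ∷ # 3 ∷ []) (# 2 ∷ # 0 ∷ # 1 ∷ # 3 ∷ [])

ranking3124 : Ranking p3124
ranking3124 = ranking p3124 (# 2 ∷ # 0 ∷ # 1 ∷ # 3 ∷ []) (# 1 ∷ # 2 ∷ # 0 ∷ # 3 ∷ [])

ranking2413 : Ranking p2413
ranking2413 = ranking p2413 (# 1 ∷ # 3 ∷ # 0 ∷ # 2 ∷ []) (# 2 ∷ # 0 ∷ # 3 ∷ # 1 ∷ [])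

ranking3142 : Ranking p3142
ranking3142 = ranking p3142 (# 2 ∷ # 0 ∷ # 3 ∷ # 1 ∷ []) (# 1 ∷ # 3 ∷ # 0 ∷ # 2 ∷ [])

contains-by-ranking : ∀ {m k} (σ : Permutation′ m) {π : Vec ℕ k} (R : Ranking π)
  (qs : Vec (Fin m) k) → Linked _<_ qs →
  Linked _<_ (tabulate (val σ ∘ lookup qs ∘ Ranking.unrank R)) → Contains σ π
contains-by-ranking σ {π} R qs positions values =
  lookup qs , (λ a b → Linked.lookup⁺ <-trans positions) , λ a b → mk⇔ (forward a b) (backward a b)
  where
  open Ranking R
  g : Fin _ → Fin _
  g = val σ ∘ lookup qs

  g∘unrank∘rank : ∀ a → lookup (tabulate (g ∘ unrank)) (rank a) ≡ g a
  g∘unrank∘rank a = trans (lookup∘tabulate (g ∘ unrank) (rank a)) (cong g (unrank-rank a))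

  forward : ∀ a b → lookup π a ℕ.< lookup π b → g a < g b
  forward a b lt = subst₂ _<_ (g∘unrank∘rank a) (g∘unrank∘rank b)
    (Linked.lookup⁺ <-trans values (rank-< lt))

  backward : ∀ a b → g a < g b → lookup π a ℕ.< lookup π b
  backward a b lt with ℕ.<-cmp (lookup π a) (lookup π b)
  ... | tri< π<  _ _ = π<
  ... | tri≈ _ π≡ _ = contradiction (cong g (lookup-injective π≡)) (λ e → <-irrefl e lt)
  ... | tri> _ _ π> = contradiction (forward b a π>) (<-asym lt)

module LeftToRightMinima {m n : ℕ} (σ : Permutation′ m) (p : Fin n → Fin m)
                         (enum : LRMinEnum σ p) where

  p-increasing : ∀ {a b} → a < b → p a < p b
  p-increasing = proj₁ enum _ _

  p-monotone : ∀ {a b} → a ≤ b → p a ≤ p b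
  p-monotone {a} {b} a≤b with <-cmp a b
  ... | tri< a<b _ _ = ℕ.<⇒≤ (p-increasing a<b)
  ... | tri≈ _ refl _ = ≤-refl
  ... | tri> _ _ b<a = contradiction a≤b (ℕ.<⇒≱ b<a)

  p-isLRMin : ∀ a → IsLRMin σ (p a)
  p-isLRMin a = Equivalence.from (proj₂ enum (p a)) (a , refl)

  minima-decreasing : ∀ {a b} → a < b → val σ (p b) < val σ (p a)
  minima-decreasing a<b = p-isLRMin _ _ (p-increasing a<b)

  module _ {x : Fin m} {i j : Fin n} (x∈ : InCell σ p x i j) where

    cell-after : ∀ {j′} → j′ ≤ j → p j′ < x
    cell-after j′≤j = ℕ.≤-<-trans (p-monotone j′≤j) (proj₁ (proj₂ x∈))

    cell-before : ∀ {l} → j < l → x < p l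
    cell-before {l} j<l = ≤∧≢⇒< (ℕ.≮⇒≥ (proj₁ (proj₂ (proj₂ x∈)) l j<l))
      (λ x≡ → proj₁ x∈ (subst (IsLRMin σ) (sym x≡) (p-isLRMin l)))

    cell-above : val σ (p i) < val σ x
    cell-above = proj₁ (proj₂ (proj₂ (proj₂ x∈)))

    cell-below : ∀ {i′} → i′ < i → val σ x < val σ (p i′)
    cell-below {i′} i′<i = ≤∧≢⇒< (ℕ.≮⇒≥ (proj₂ (proj₂ (proj₂ (proj₂ x∈))) i′ i′<i))
      (λ v≡ → proj₁ x∈ (subst (IsLRMin σ) (val-injective σ (sym v≡)) (p-isLRMin i′)))

  module _ {x y : Fin m} {i j k l : Fin n}
           (x∈ : InCell σ p x i j) (y∈ : InCell σ p y k l) where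

    edgeU⇒contains2314 : EdgeU i j k l → Contains σ p2314
    edgeU⇒contains2314 (i≤j , _ , k<i , j<l) =
      contains-by-ranking σ ranking2314 (p i ∷ x ∷ p l ∷ y ∷ [])
        (cell-after x∈ i≤j ∷ cell-before x∈ j<l ∷ cell-after y∈ ≤-refl ∷ [-])
        (minima-decreasing (ℕ.≤-<-trans i≤j j<l) ∷ cell-above x∈
          ∷ <-trans (cell-below x∈ k<i) (cell-above y∈) ∷ [-])

    edgeU⇒contains3124 : EdgeU i j k l → Contains σ p3124
    edgeU⇒contains3124 (i≤j , _ , k<i , j<l) =
      contains-by-ranking σ ranking3124 (p k ∷ p i ∷ x ∷ y ∷ [])
        (p-increasing k<i ∷ cell-after x∈ i≤j
          ∷ <-trans (cell-before x∈ j<l) (cell-after y∈ ≤-refl) ∷ [-])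
        (cell-above x∈ ∷ cell-below x∈ k<i ∷ cell-above y∈ ∷ [-])

    edgeD⇒k≤j : EdgeD i j k l → k ≤ j
    edgeD⇒k≤j (_ , _ , i<k , j<l , rectangle) =
      rectangle k j (ℕ.<⇒≤ i<k) ≤-refl ≤-refl (ℕ.<⇒≤ j<l)

    edgeD⇒contains2413 : EdgeD i j k l → Contains σ p2413
    edgeD⇒contains2413 e@(_ , _ , i<k , j<l , _) =
      contains-by-ranking σ ranking2413 (p k ∷ x ∷ p l ∷ y ∷ [])
        (cell-after x∈ (edgeD⇒k≤j e) ∷ cell-before x∈ j<l ∷ cell-after y∈ ≤-refl ∷ [-])
        (minima-decreasing (ℕ.≤-<-trans (edgeD⇒k≤j e) j<l) ∷ cell-above y∈
          ∷ <-trans (cell-below y∈ i<k) (cell-above x∈) ∷ [-])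

    edgeD⇒contains3142 : EdgeD i j k l → Contains σ p3142
    edgeD⇒contains3142 e@(_ , _ , i<k , j<l , _) =
      contains-by-ranking σ ranking3142 (p i ∷ p k ∷ x ∷ y ∷ [])
        (p-increasing i<k ∷ cell-after x∈ (edgeD⇒k≤j e)
          ∷ <-trans (cell-before x∈ j<l) (cell-after y∈ ≤-refl) ∷ [-])
        (cell-above y∈ ∷ cell-below y∈ i<k ∷ cell-above x∈ ∷ [-])

  active-independentU : (Avoids σ p2314 ⊎ Avoids σ p3124) → Independent EdgeU (Active σ p)
  active-independentU avoids i j k l (x , x∈) (y , y∈) e =
    [ (λ av → av (edgeU⇒contains2314 x∈ y∈ e))
    , (λ av → av (edgeU⇒contains3124 x∈ y∈ e)) ] avoids

  active-independentD : (Avoids σ p2413 ⊎ Avoids σ p3142) → Independent EdgeD (Active σ p)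
  active-independentD avoids i j k l (x , x∈) (y , y∈) e =
    [ (λ av → av (edgeD⇒contains2413 x∈ y∈ e))
    , (λ av → av (edgeD⇒contains3142 x∈ y∈ e)) ] avoids

lemma3p2 : (m n : ℕ) (σ : Permutation′ m) (p : Fin n → Fin m) → LRMinEnum σ p →
    ((Avoids σ p2314 ⊎ Avoids σ p3124) → Independent EdgeU (Active σ p)) ×
    ((Avoids σ p2413 ⊎ Avoids σ p3142) → Independent EdgeD (Active σ p))
lemma3p2 m n σ p enum = active-independentU , active-independentD
  where open LeftToRightMinima σ p enum
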